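{- There exists an algorithm which, given a positive integer $n$ as input, returns all $n$-good pairs and runs in $O(\log n)$ steps (arithmetic operations on integers).
   Context: For positive integers $a_1,a_2$, the $(a_1,a_2)$-Fibonacci walk is $w_k=w_k(a_1,a_2)$ with $w_1=a_1$, $w_2=a_2$, $w_{k+2}=w_{k+1}+w_k$ for $k\ge1$. Let $s(n;a_1,a_2)$ be the integer $s$ with $w_s(a_1,a_2)=n$ ($-\infty$ if none), and $s(n)=\max_{a_1,a_2\ge1}s(n;a_1,a_2)$. A pair $(a_1,a_2)$ is $n$-good if $a_1,a_2\ge1$ and $s(n;a_1,a_2)=s(n)$. -}

module Defs where

open import Data.Nat using (ℕ; zero; suc; _+_; _*_; _∸_; _≤_; _<ᵇ_; _≡ᵇ_)
open import Data.Nat.DivMod using (_/_; _%_)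
open import Data.Bool using (Bool; true; false; if_then_else_)
open import Data.List using (List; []; _∷_; reverse)
open import Data.Maybe using (Maybe; just; nothing)
open import Data.Product using (_×_; _,_; ∃-syntax)
open import Relation.Binary.PropositionalEquality using (_≡_)

-- Fibonacci walks.  walk a₁ a₂ k = w_k(a₁,a₂) for k ≥ 1;
-- the index 0 is outside the paper's range and is set to 0
-- (so it never equals a positive n).

walk : ℕ → ℕ → ℕ → ℕ
walk a₁ a₂ zero = 0
walk a₁ a₂ (suc zero) = a₁
walk a₁ a₂ (suc (suc zero)) = a₂
walk a₁ a₂ (suc (suc (suc k))) = walk a₁ a₂ (suc (suc k)) + walk a₁ a₂ (suc k)

IsIndex : ℕ → ℕ → ℕ → ℕ → Set
IsIndex n a₁ a₂ s = (walk a₁ a₂ s ≡ n) × (∀ t → walk a₁ a₂ t ≡ n → t ≤ s)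

IsS : ℕ → ℕ → Set
IsS n s = (∃[ a₁ ] ∃[ a₂ ] (1 ≤ a₁ × 1 ≤ a₂ × IsIndex n a₁ a₂ s))
        × (∀ b₁ b₂ t → 1 ≤ b₁ → 1 ≤ b₂ → walk b₁ b₂ t ≡ n → t ≤ s)

Good : ℕ → ℕ → ℕ → Set
Good n a₁ a₂ = 1 ≤ a₁ × 1 ≤ a₂ × ∃[ s ] (IsIndex n a₁ a₂ s × IsS n s)

-- Model of computation: a unit-cost register machine (RAM) over ℕ.
-- Registers are indexed by ℕ; each executed instruction is one step
-- (one arithmetic operation / comparison / jump / output).

Reg : Set
Reg = ℕ

data Instr : Set where
  const : Reg → ℕ → Instr
  add   : Reg → Reg → Reg → Instr
  sub   : Reg → Reg → Reg → Instr
  mul   : Reg → Reg → Reg → Instr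
  quot  : Reg → Reg → Reg → Instr       -- d := ⌊a / b⌋   (0 if b = 0)
  rem   : Reg → Reg → Reg → Instr       -- d := a mod b  (0 if b = 0)
  jlt   : Reg → Reg → ℕ → Instr
  jeq   : Reg → Reg → ℕ → Instr
  jmp   : ℕ → Instr
  out   : Reg → Reg → Instr
  halt  : Instr

Program : Set
Program = List Instr

record Config : Set where
  constructor cfg
  field
    pc     : ℕ
    regs   : ℕ → ℕ
    output : List (ℕ × ℕ)   -- in reverse order of emission

fetch : Program → ℕ → Maybe Instr
fetch [] _ = nothing
fetch (i ∷ is) zero = just i
fetch (i ∷ is) (suc k) = fetch is k

update : (ℕ → ℕ) → Reg → ℕ → (ℕ → ℕ)
update ρ d v r = if r ≡ᵇ d then v else ρ r

safeDiv : ℕ → ℕ → ℕ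
safeDiv a zero = 0
safeDiv a (suc b) = a / suc b

safeMod : ℕ → ℕ → ℕ
safeMod a zero = 0
safeMod a (suc b) = a % suc b

exec : Instr → Config → Config
exec (const d c) (cfg p ρ o) = cfg (suc p) (update ρ d c) o
exec (add d a b) (cfg p ρ o) = cfg (suc p) (update ρ d (ρ a + ρ b)) o
exec (sub d a b) (cfg p ρ o) = cfg (suc p) (update ρ d (ρ a ∸ ρ b)) o
exec (mul d a b) (cfg p ρ o) = cfg (suc p) (update ρ d (ρ a * ρ b)) o
exec (quot d a b) (cfg p ρ o) = cfg (suc p) (update ρ d (safeDiv (ρ a) (ρ b))) o
exec (rem d a b) (cfg p ρ o) = cfg (suc p) (update ρ d (safeMod (ρ a) (ρ b))) o
exec (jlt a b t) (cfg p ρ o) = cfg (if ρ a <ᵇ ρ b then t else suc p) ρ o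
exec (jeq a b t) (cfg p ρ o) = cfg (if ρ a ≡ᵇ ρ b then t else suc p) ρ o
exec (jmp t) (cfg p ρ o) = cfg t ρ o
exec (out a b) (cfg p ρ o) = cfg (suc p) ρ ((ρ a , ρ b) ∷ o)
exec halt c = c

run : Program → ℕ → Config → Maybe (List (ℕ × ℕ))
run P fuel c with fetch P (Config.pc c)
... | nothing = just (reverse (Config.output c))
... | just halt = just (reverse (Config.output c))
... | just i with fuel
...   | zero = nothing
...   | suc f = run P f (exec i c)

initial : ℕ → Config
initial n = cfg 0 (λ r → if r ≡ᵇ 0 then n else 0) []

HaltsWith : Program → ℕ → ℕ → List (ℕ × ℕ) → Set
HaltsWith P n t o = run P t (initial n) ≡ just o

{-# OPTIONS --safe #-}
-- At step s ≥ 3 the (a, b)-walk is the linear form P a + Q b with (P, Q) consecutive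
-- Fibonacci numbers, so the n-good pairs are the positive solutions of P a + Q b = n
-- for the largest level s that has one.  A row (β, α) with P α = Q β + 1 parametrises these
-- solutions as (a, b) = (α n - Q x, P x - β n), x = β a + α b, over the integers x with
-- β n < P x and Q x < α n.  So level s is reachable iff the largest x with Q x < α n
-- satisfies β n < P x, and at the largest reachable level only the three largest x
-- occur: for a smaller x the pair (a', b') at the largest x has a' ≤ Q < b', and
-- (b' - a', a') would reach n one level later.  The program climbs the levels, updating
-- (P, Q, α, β) with O(1) operations each, then emits at most three pairs; as the
-- Fibonacci numbers grow exponentially there are O(log n) levels.

module Submission where

open import Defs
open import Data.Nat using (ℕ; zero; suc; _+_; _*_; _∸_; _^_; _≤_; _<_; z≤n; s≤s; _≤?_; _<ᵇ_; _≡ᵇ_; NonZero; pred; >-nonZero)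
open import Data.Nat.Properties
open import Data.Nat.DivMod using (_/_; _%_; m/n*n≤m; m*n/n≡m; /-monoˡ-≤; m≡m%n+[m/n]*n; m%n<n)
open import Data.Nat.Logarithm using (⌊log₂_⌋; ⌊log₂⌋-mono-≤; ⌊log₂[2^n]⌋≡n)
open import Data.Nat.Tactic.RingSolver using (solve-∀)
open import Data.Bool using (Bool; true; false; T; if_then_else_)
open import Data.Unit using (tt)
open import Data.Product using (_×_; _,_; ∃-syntax; proj₁; proj₂)
open import Data.Sum using (_⊎_; inj₁; inj₂)
open import Data.List using (List; []; _∷_; reverse)
open import Data.List.Relation.Unary.Any using (here; there)
open import Data.List.Relation.Unary.Any.Properties using (reverse⁺; reverse⁻)
open import Data.List.Membership.Propositional using (_∈_)
open import Data.Maybe using (just; fromMaybe)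
open import Data.Empty using (⊥-elim)
open import Relation.Nullary using (¬_; yes; no)
open import Function using (_∘_)
open import Function.Bundles using (_⇔_; mk⇔; Equivalence)
open import Function.Properties.Equivalence using () renaming (trans to ⇔-trans)
open import Relation.Binary.PropositionalEquality

fib : ℕ → ℕ
fib zero = 0
fib (suc zero) = 1
fib (suc (suc k)) = fib (suc k) + fib k

fib-≤-suc : ∀ k → fib k ≤ fib (suc k)
fib-≤-suc zero = z≤n
fib-≤-suc (suc k) = m≤m+n _ _

walk-fib : ∀ a b k → walk a b (2 + k) ≡ fib k * a + fib (1 + k) * b
walk-fib a b zero = lemma a b
  where lemma : ∀ a b → b ≡ 0 * a + 1 * b
        lemma = solve-∀
walk-fib a b (suc zero) = lemma a b
  where lemma : ∀ a b → b + a ≡ 1 * a + 1 * b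
        lemma = solve-∀
walk-fib a b (suc (suc k)) = begin
  walk a b (3 + k) + walk a b (2 + k)
    ≡⟨ cong₂ _+_ (walk-fib a b (suc k)) (walk-fib a b k) ⟩
  (F₁ * a + (F₁ + F₀) * b) + (F₀ * a + F₁ * b)
    ≡⟨ lemma F₀ F₁ a b ⟩
  (F₁ + F₀) * a + ((F₁ + F₀) + F₁) * b ∎
  where
  open ≡-Reasoning
  F₀ = fib k
  F₁ = fib (suc k)
  lemma : ∀ F₀ F₁ a b → (F₁ * a + (F₁ + F₀) * b) + (F₀ * a + F₁ * b)
                      ≡ (F₁ + F₀) * a + ((F₁ + F₀) + F₁) * b
  lemma = solve-∀

walk-suc : ∀ a b s → 1 ≤ s → walk a b (suc s) ≡ walk b (a + b) s
walk-suc a b 1 _ = refl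
walk-suc a b 2 _ = +-comm b a
walk-suc a b (suc (suc (suc s))) _ =
  cong₂ _+_ (walk-suc a b (suc (suc s)) (s≤s z≤n)) (walk-suc a b (suc s) (s≤s z≤n))

Hits : ℕ → ℕ → ℕ → ℕ → Set
Hits n s a b = 1 ≤ a × 1 ≤ b × walk a b s ≡ n

Reachable : ℕ → ℕ → Set
Reachable n s = ∃[ a ] ∃[ b ] Hits n s a b

hits-pred : ∀ {n s a b} → 1 ≤ s → Hits n (suc s) a b → Hits n s b (a + b)
hits-pred {s = s} {a} {b} s≥1 (a≥1 , b≥1 , hit) =
  b≥1 , ≤-trans b≥1 (m≤n+m b a) , trans (sym (walk-suc a b s s≥1)) hit

hits-suc : ∀ {n s a b} → 1 ≤ s → a < b → Hits n s a b → Hits n (suc s) (b ∸ a) a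
hits-suc {s = s} {a} {b} s≥1 a<b (a≥1 , _ , hit) =
  m<n⇒0<n∸m a<b , a≥1 ,
  trans (walk-suc (b ∸ a) a s s≥1) (subst (λ c → walk a c s ≡ _) (sym (m∸n+n≡m (<⇒≤ a<b))) hit)

reachable-downward : ∀ {n s} t → 1 ≤ s → Reachable n (t + s) → Reachable n s
reachable-downward zero s≥1 r = r
reachable-downward {s = s} (suc t) s≥1 (a , b , h) =
  reachable-downward t s≥1 (b , a + b , hits-pred (≤-trans s≥1 (m≤n+m s t)) h)

module MaximalLevel {n s : ℕ} (n≥1 : 1 ≤ n) (s≥1 : 1 ≤ s)
  (reachable : Reachable n s) (unreachable : ¬ Reachable n (suc s)) where

  hits-≤ : ∀ {a b} t → Hits n t a b → t ≤ s
  hits-≤ zero _ = z≤n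
  hits-≤ (suc t) h with suc t ≤? s
  ... | yes t<s = t<s
  ... | no t≮s = ⊥-elim (unreachable (reachable-downward (suc t ∸ suc s) (s≤s z≤n)
                   (subst (Reachable n) (sym (m∸n+n≡m (≰⇒> t≮s))) (_ , _ , h))))

  isS : IsS n s
  isS = let (a , b , a≥1 , b≥1 , hit) = reachable in
    (a , b , a≥1 , b≥1 , hit , λ t e → hits-≤ t (a≥1 , b≥1 , e)) ,
    λ _ _ t b₁≥1 b₂≥1 e → hits-≤ t (b₁≥1 , b₂≥1 , e)

  good⇔hits : ∀ a b → Good n a b ⇔ Hits n s a b
  good⇔hits a b = mk⇔ to
    (λ (a≥1 , b≥1 , hit) → a≥1 , b≥1 , s , (hit , λ t e → hits-≤ t (a≥1 , b≥1 , e)) , isS)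
    where
    to : Good n a b → Hits n s a b
    to (a≥1 , b≥1 , s′ , (hit , _) , (_ , s′-max)) =
      let (c , d , c≥1 , d≥1 , hit′) = reachable in
      a≥1 , b≥1 , subst (λ t → walk a b t ≡ n) (≤-antisym (hits-≤ s′ (a≥1 , b≥1 , hit)) (s′-max c d s c≥1 d≥1 hit′)) hit

safeDiv≡/ : ∀ m n .{{_ : NonZero n}} → safeDiv m n ≡ m / n
safeDiv≡/ m (suc n) = refl

n*[pred[m]/n]<m : ∀ m n .{{_ : NonZero n}} → 1 ≤ m → n * (pred m / n) < m
n*[pred[m]/n]<m (suc m) n _ = s≤s (begin
  n * (m / n) ≡⟨ *-comm n (m / n) ⟩
  m / n * n   ≤⟨ m/n*n≤m m n ⟩
  m           ∎)
  where open ≤-Reasoning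

n*o<m⇒o≤pred[m]/n : ∀ m n o .{{_ : NonZero n}} → n * o < m → o ≤ pred m / n
n*o<m⇒o≤pred[m]/n m n o n*o<m = begin
  o             ≡⟨ m*n/n≡m o n ⟨
  o * n / n     ≤⟨ /-monoˡ-≤ n (subst (_≤ pred m) (*-comm n o) (<⇒≤pred n*o<m)) ⟩
  pred m / n    ∎
  where open ≤-Reasoning

m≤n*[pred[m]/n]+n : ∀ m n .{{_ : NonZero n}} → m ≤ n * (pred m / n) + n
m≤n*[pred[m]/n]+n zero n = z≤n
m≤n*[pred[m]/n]+n (suc m) n = begin-strict
  m                     ≡⟨ m≡m%n+[m/n]*n m n ⟩
  m % n + m / n * n     <⟨ +-monoˡ-< (m / n * n) (m%n<n m n) ⟩
  n + m / n * n         ≡⟨ +-comm n _ ⟩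
  m / n * n + n         ≡⟨ cong (_+ n) (*-comm (m / n) n) ⟩
  n * (m / n) + n       ∎
  where open ≤-Reasoning

-- (β, α) completes the row (P, Q) to an integer matrix of determinant 1.
-- `completion-next` completes (Q, Q + P) by subtracting the old row, multiplied by
-- [[0, 1], [1, 1]] (determinant -1), from (Q, Q + P); the two inequalities make
-- these truncated subtractions exact.
record Completion (P Q α β : ℕ) : Set where
  field
    det     : P * α ≡ Q * β + 1
    α≤Q     : α ≤ Q
    α+β≤Q+P : α + β ≤ Q + P

completion-next : ∀ {P Q α β} → Completion P Q α β →
                  Completion Q (Q + P) (Q + P ∸ (α + β)) (Q ∸ α)
completion-next {P} {Q} {α} {β} c = record
  { det = det′ ; α≤Q = m∸n≤m (Q + P) (α + β) ; α+β≤Q+P = +-mono-≤ (m∸n≤m (Q + P) (α + β)) (m∸n≤m Q α) }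
  where
  open Completion c
  open ≡-Reasoning
  α′ = Q + P ∸ (α + β)
  β′ = Q ∸ α
  det′ : Q * α′ ≡ (Q + P) * β′ + 1
  det′ = +-cancelʳ-≡ (Q * (α + β)) _ _ (begin
    Q * α′ + Q * (α + β)              ≡⟨ *-distribˡ-+ Q α′ (α + β) ⟨
    Q * (α′ + (α + β))                ≡⟨ cong (Q *_) (m∸n+n≡m α+β≤Q+P) ⟩
    Q * (Q + P)                       ≡⟨ cong (λ t → t * (Q + P)) (m∸n+n≡m α≤Q) ⟨
    (β′ + α) * (Q + P)                ≡⟨ expand β′ α Q P ⟩
    (Q + P) * β′ + (Q * α + P * α)    ≡⟨ cong (λ t → (Q + P) * β′ + (Q * α + t)) det ⟩
    (Q + P) * β′ + (Q * α + (Q * β + 1)) ≡⟨ regroup ((Q + P) * β′) Q α β ⟩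
    (Q + P) * β′ + 1 + Q * (α + β)    ∎)
    where
    expand : ∀ b a Q P → (b + a) * (Q + P) ≡ (Q + P) * b + (Q * a + P * a)
    expand = solve-∀
    regroup : ∀ c Q a b → c + (Q * a + (Q * b + 1)) ≡ c + 1 + Q * (a + b)
    regroup = solve-∀

collectDown : (ℕ → Bool) → (ℕ → ℕ × ℕ) → ℕ → ℕ → List (ℕ × ℕ) → List (ℕ × ℕ)
collectDown ok f zero    y acc = acc
collectDown ok f (suc k) y acc = collectDown ok f k (y ∸ 1) (if ok y then f y ∷ acc else acc)

module _ (ok : ℕ → Bool) (f : ℕ → ℕ × ℕ) where

  ∈-collectDown⁻ : ∀ {z} k y acc → z ∈ collectDown ok f k y acc →
                   z ∈ acc ⊎ ∃[ d ] (d < k × T (ok (y ∸ d)) × z ≡ f (y ∸ d))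
  ∈-collectDown⁻ zero y acc z∈ = inj₁ z∈
  ∈-collectDown⁻ (suc k) y acc z∈ with ∈-collectDown⁻ k (y ∸ 1) _ z∈
  ... | inj₂ (d , d<k , okd , z≡) =
    inj₂ (suc d , s≤s d<k , subst (T ∘ ok) (∸-+-assoc y 1 d) okd , trans z≡ (cong f (∸-+-assoc y 1 d)))
  ... | inj₁ z∈acc′ with ok y in ok-y
  ...   | false = inj₁ z∈acc′
  ...   | true with z∈acc′
  ...     | here z≡ = inj₂ (0 , s≤s z≤n , subst T (sym ok-y) _ , z≡)
  ...     | there z∈acc = inj₁ z∈acc

  acc⊆collectDown : ∀ {z} k y acc → z ∈ acc → z ∈ collectDown ok f k y acc
  acc⊆collectDown zero y acc z∈ = z∈
  acc⊆collectDown (suc k) y acc z∈ = acc⊆collectDown k (y ∸ 1) _ (lemma (ok y))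
    where
    lemma : ∀ b → _ ∈ (if b then f y ∷ acc else acc)
    lemma true = there z∈
    lemma false = z∈

  ∈-collectDown⁺ : ∀ {d} k y acc → d < k → T (ok (y ∸ d)) → f (y ∸ d) ∈ collectDown ok f k y acc
  ∈-collectDown⁺ {zero} (suc k) y acc _ ok-y with ok y
  ... | true = acc⊆collectDown k (y ∸ 1) _ (here refl)
  ∈-collectDown⁺ {suc d} (suc k) y acc (s≤s d<k) ok-y =
    subst (λ t → f t ∈ collectDown ok f k (y ∸ 1) (if ok y then f y ∷ acc else acc)) (∸-+-assoc y 1 d)
      (∈-collectDown⁺ k (y ∸ 1) _ d<k (subst (λ t → T (ok t)) (sym (∸-+-assoc y 1 d)) ok-y))

m*n≡o+1⇒1≤n : ∀ {m n o} → m * n ≡ o + 1 → 1 ≤ n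
m*n≡o+1⇒1≤n {m} {zero} {o} eq = ⊥-elim (0≢1+n (trans (sym (*-zeroʳ m)) (trans eq (+-comm o 1))))
m*n≡o+1⇒1≤n {n = suc _} _ = s≤s z≤n

record Coefficients (s P Q α β : ℕ) : Set where
  field
    s≥1        : 1 ≤ s
    walk≡      : ∀ a b → walk a b s ≡ P * a + Q * b
    P≥1        : 1 ≤ P
    P≤Q        : P ≤ Q
    Q≤P+P      : Q ≤ P + P
    completion : Completion P Q α β

coefficients-3 : Coefficients 3 1 1 1 0
coefficients-3 = record
  { s≥1 = s≤s z≤n ; walk≡ = walk≡ ; P≥1 = s≤s z≤n ; P≤Q = s≤s z≤n ; Q≤P+P = s≤s z≤n
  ; completion = record { det = refl ; α≤Q = s≤s z≤n ; α+β≤Q+P = s≤s z≤n } }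
  where
  walk≡ : ∀ a b → b + a ≡ 1 * a + 1 * b
  walk≡ = solve-∀

coefficients-next : ∀ {s P Q α β} → Coefficients s P Q α β →
                    Coefficients (suc s) Q (Q + P) (Q + P ∸ (α + β)) (Q ∸ α)
coefficients-next {s} {P} {Q} c = record
  { s≥1 = s≤s z≤n ; walk≡ = walk≡′ ; P≥1 = ≤-trans P≥1 P≤Q ; P≤Q = m≤m+n Q P ; Q≤P+P = +-monoʳ-≤ Q P≤Q
  ; completion = completion-next completion }
  where
  open Coefficients c
  walk≡′ : ∀ a b → walk a b (suc s) ≡ Q * a + (Q + P) * b
  walk≡′ a b = trans (walk-suc a b s s≥1) (trans (walk≡ b (a + b)) (l P Q a b))
    where l : ∀ P Q a b → P * b + Q * (a + b) ≡ Q * a + (Q + P) * b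
          l = solve-∀

module Level {n s P Q α β : ℕ} (n≥1 : 1 ≤ n) (coefficients : Coefficients s P Q α β) where

  open Coefficients coefficients
  open Completion completion using (det)

  coordinate : ℕ → ℕ → ℕ
  coordinate a b = β * a + α * b

  hits⇒coordinate : ∀ {a b} → Hits n s a b →
    Q * coordinate a b + a ≡ α * n × P * coordinate a b ≡ β * n + b
  hits⇒coordinate {a} {b} (_ , _ , hit) = qx+a , px
    where
    open ≡-Reasoning
    n≡ : n ≡ P * a + Q * b
    n≡ = trans (sym hit) (walk≡ a b)
    qx+a = begin
      Q * (β * a + α * b) + a   ≡⟨ l₁ Q β a α b ⟩
      (Q * β + 1) * a + Q * α * b ≡⟨ cong (λ t → t * a + Q * α * b) det ⟨
      P * α * a + Q * α * b     ≡⟨ l₂ P α a Q b ⟩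
      α * (P * a + Q * b)       ≡⟨ cong (α *_) n≡ ⟨
      α * n                     ∎
      where
      l₁ : ∀ Q β a α b → Q * (β * a + α * b) + a ≡ (Q * β + 1) * a + Q * α * b
      l₁ = solve-∀
      l₂ : ∀ P α a Q b → P * α * a + Q * α * b ≡ α * (P * a + Q * b)
      l₂ = solve-∀
    px = begin
      P * (β * a + α * b)       ≡⟨ l₁ P β a α b ⟩
      β * P * a + P * α * b     ≡⟨ cong (λ t → β * P * a + t * b) det ⟩
      β * P * a + (Q * β + 1) * b ≡⟨ l₂ β P a Q b ⟩
      β * (P * a + Q * b) + b   ≡⟨ cong (λ t → β * t + b) n≡ ⟨
      β * n + b                 ∎
      where
      l₁ : ∀ P β a α b → P * (β * a + α * b) ≡ β * P * a + P * α * b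
      l₁ = solve-∀
      l₂ : ∀ β P a Q b → β * P * a + (Q * β + 1) * b ≡ β * (P * a + Q * b) + b
      l₂ = solve-∀

  coordinate⇒hits : ∀ {a b} x → 1 ≤ a → 1 ≤ b → Q * x + a ≡ α * n → P * x ≡ β * n + b →
    Hits n s a b
  coordinate⇒hits {a} {b} x a≥1 b≥1 qx+a px =
    a≥1 , b≥1 , trans (walk≡ a b) (+-cancelʳ-≡ (P * (Q * x) + Q * (β * n)) _ _ (begin
      P * a + Q * b + (P * (Q * x) + Q * (β * n)) ≡⟨ l₁ P Q a b x (β * n) ⟩
      P * (Q * x + a) + Q * (β * n + b)           ≡⟨ cong₂ (λ u v → P * u + Q * v) qx+a (sym px) ⟩
      P * (α * n) + Q * (P * x)                   ≡⟨ l₂ P α n Q x ⟩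
      P * α * n + P * (Q * x)                     ≡⟨ cong (λ t → t * n + P * (Q * x)) det ⟩
      (Q * β + 1) * n + P * (Q * x)               ≡⟨ l₃ Q β n P x ⟩
      n + (P * (Q * x) + Q * (β * n))             ∎))
    where
    open ≡-Reasoning
    l₁ : ∀ P Q a b x m → P * a + Q * b + (P * (Q * x) + Q * m) ≡ P * (Q * x + a) + Q * (m + b)
    l₁ = solve-∀
    l₂ : ∀ P α n Q x → P * (α * n) + Q * (P * x) ≡ P * α * n + P * (Q * x)
    l₂ = solve-∀
    l₃ : ∀ Q β n P x → (Q * β + 1) * n + P * (Q * x) ≡ n + (P * (Q * x) + Q * (β * n))
    l₃ = solve-∀

  pairAt : ℕ → ℕ × ℕ
  pairAt x = α * n ∸ Q * x , P * x ∸ β * n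

  pairAt-hits : ∀ x → Q * x < α * n → β * n < P * x → Hits n s (proj₁ (pairAt x)) (proj₂ (pairAt x))
  pairAt-hits x qx<αn βn<px = coordinate⇒hits x (m<n⇒0<n∸m qx<αn) (m<n⇒0<n∸m βn<px)
    (m+[n∸m]≡n (<⇒≤ qx<αn)) (sym (m+[n∸m]≡n (<⇒≤ βn<px)))

  instance
    Q-nonZero : NonZero Q
    Q-nonZero = >-nonZero (≤-trans P≥1 P≤Q)

  αn≥1 : 1 ≤ α * n
  αn≥1 = *-mono-≤ (m*n≡o+1⇒1≤n {P} {α} det) n≥1

  -- the largest x with Q x < α n
  top : ℕ
  top = safeDiv (α * n ∸ 1) Q

  top≡ : top ≡ pred (α * n) / Q
  top≡ = safeDiv≡/ (α * n ∸ 1) Q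

  Q*top<αn : Q * top < α * n
  Q*top<αn = subst (λ t → Q * t < α * n) (sym top≡) (n*[pred[m]/n]<m (α * n) Q αn≥1)

  ≤top : ∀ x → Q * x < α * n → x ≤ top
  ≤top x qx<αn = subst (x ≤_) (sym top≡) (n*o<m⇒o≤pred[m]/n (α * n) Q x qx<αn)

  αn≤Q*top+Q : α * n ≤ Q * top + Q
  αn≤Q*top+Q = subst (λ t → α * n ≤ Q * t + Q) (sym top≡) (m≤n*[pred[m]/n]+n (α * n) Q)

  module _ {a b : ℕ} (h : Hits n s a b) where

    coordinate≤top : coordinate a b ≤ top
    coordinate≤top = ≤top _ (subst (Q * coordinate a b <_) (proj₁ (hits⇒coordinate h)) (m<m+n _ (proj₁ h)))

    βn<P*coordinate : β * n < P * coordinate a b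
    βn<P*coordinate = subst (β * n <_) (sym (proj₂ (hits⇒coordinate h))) (m<m+n _ (proj₁ (proj₂ h)))

    pairAt-coordinate : (a , b) ≡ pairAt (coordinate a b)
    pairAt-coordinate = cong₂ _,_
      (trans (sym (m+n∸m≡n (Q * x) a)) (cong (_∸ Q * x) (proj₁ (hits⇒coordinate h))))
      (trans (sym (m+n∸m≡n (β * n) b)) (cong (_∸ β * n) (sym (proj₂ (hits⇒coordinate h)))))
      where x = coordinate a b

  reachable⇔ : Reachable n s ⇔ β * n < P * top
  reachable⇔ = mk⇔
    (λ (_ , _ , h) → <-≤-trans (βn<P*coordinate h) (*-monoʳ-≤ P (coordinate≤top h)))
    (λ βn<P*top → _ , _ , pairAt-hits top Q*top<αn βn<P*top)

  -- Otherwise the pair (a', b') at x = top has a' ≤ Q ≤ 2P < b'.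
  top≤coordinate+2 : ¬ Reachable n (suc s) → ∀ {a b} → Hits n s a b → top ≤ coordinate a b + 2
  top≤coordinate+2 unreachable {a} {b} h with top ≤? coordinate a b + 2
  ... | yes top≤x+2 = top≤x+2
  ... | no top≰x+2 = ⊥-elim (unreachable (_ , _ , hits-suc {s = s} s≥1 a′<b′ (pairAt-hits top Q*top<αn βn<P*top)))
    where
    open ≤-Reasoning
    x = coordinate a b
    βn<P*top = Equivalence.to reachable⇔ (a , b , h)
    b+3P≤P*top∸βn : b + P * 3 ≤ P * top ∸ β * n
    b+3P≤P*top∸βn = m+n≤o⇒m≤o∸n (b + P * 3) (begin
      b + P * 3 + β * n     ≡⟨ l (β * n) b P ⟩
      (β * n + b) + P * 3   ≡⟨ cong (_+ P * 3) (proj₂ (hits⇒coordinate h)) ⟨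
      P * x + P * 3         ≡⟨ *-distribˡ-+ P x 3 ⟨
      P * (x + 3)           ≤⟨ *-monoʳ-≤ P (subst (_≤ top) (sym (+-suc x 2)) (≰⇒> top≰x+2)) ⟩
      P * top               ∎)
      where l : ∀ m b P → b + P * 3 + m ≡ (m + b) + P * 3
            l = solve-∀
    a′<b′ : α * n ∸ Q * top < P * top ∸ β * n
    a′<b′ = begin-strict
      α * n ∸ Q * top   ≤⟨ m≤n+o⇒m∸n≤o (α * n) (Q * top) αn≤Q*top+Q ⟩
      Q                 ≤⟨ Q≤P+P ⟩
      P + P             <⟨ s≤s (subst (P + P ≤_) (l P) (m≤m+n (P + P) P)) ⟩
      1 + P * 3         ≤⟨ +-monoˡ-≤ (P * 3) (proj₁ (proj₂ h)) ⟩
      b + P * 3         ≤⟨ b+3P≤P*top∸βn ⟩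
      P * top ∸ β * n   ∎
      where l : ∀ P → P + P + P ≡ P * 3
            l = solve-∀

  βn<ᵇP* : ℕ → Bool
  βn<ᵇP* y = β * n <ᵇ P * y

  candidates : List (ℕ × ℕ)
  candidates = collectDown βn<ᵇP* pairAt 3 top []

  candidate⇒hits : ∀ {a b} → (a , b) ∈ candidates → Hits n s a b
  candidate⇒hits ab∈ with ∈-collectDown⁻ βn<ᵇP* pairAt 3 top [] ab∈
  ... | inj₂ (d , _ , βn<P*y , refl) =
    pairAt-hits (top ∸ d) (≤-<-trans (*-monoʳ-≤ Q (m∸n≤m top d)) Q*top<αn) (<ᵇ⇒< _ _ βn<P*y)

  hits⇒candidate : ¬ Reachable n (suc s) → ∀ {a b} → Hits n s a b → (a , b) ∈ candidates
  hits⇒candidate unreachable {a} {b} h =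
    subst (_∈ candidates) (trans (cong pairAt top∸d≡x) (sym (pairAt-coordinate h)))
      (∈-collectDown⁺ βn<ᵇP* pairAt 3 top [] d<3 (subst (λ y → T (β * n <ᵇ P * y)) (sym top∸d≡x) (<⇒<ᵇ (βn<P*coordinate h))))
    where
    x = coordinate a b
    d = top ∸ x
    d<3 : d < 3
    d<3 = s≤s (m≤n+o⇒m∸n≤o top x (top≤coordinate+2 unreachable h))
    top∸d≡x : top ∸ d ≡ x
    top∸d≡x = m∸[m∸n]≡n (coordinate≤top h)

  candidates⇔good : Reachable n s → ¬ Reachable n (suc s) → ∀ a b → (a , b) ∈ candidates ⇔ Good n a b
  candidates⇔good reachable unreachable a b = mk⇔
    (λ ab∈ → Equivalence.from (good⇔hits a b) (candidate⇒hits ab∈))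
    (λ good → hits⇒candidate unreachable (Equivalence.to (good⇔hits a b) good))
    where open MaximalLevel {s = s} n≥1 s≥1 reachable unreachable

-- Registers: 0 = n, and (1, 2, 3, 4) = (P, Q, α, β) of the current level.  Constants
-- are reloaded right before they are read (register 6 as 0 in `add d 6 r`, which
-- copies r), so that all register reads in the proofs below reduce definitionally.
program : Program
program =
  const 1 1 ∷ const 2 1 ∷ const 3 1 ∷
  -- 3: test the next level, with coefficients (Q, Q + P, Q + P ∸ (α + β), Q ∸ α)
  add 7 2 1 ∷ add 8 3 4 ∷ sub 8 7 8 ∷ sub 9 2 3 ∷ const 11 1 ∷
  mul 10 8 0 ∷ sub 10 10 11 ∷ quot 10 10 7 ∷ mul 10 2 10 ∷ mul 11 9 0 ∷
  jlt 11 10 15 ∷ jmp 21 ∷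
  -- 15: move to the next level
  const 6 0 ∷ add 1 6 2 ∷ add 2 6 7 ∷ add 3 6 8 ∷ add 4 6 9 ∷ jmp 3 ∷
  -- 21: output the candidates x = top, top - 1, top - 2 of the current level
  const 5 1 ∷ mul 10 3 0 ∷ sub 11 10 5 ∷ quot 11 11 2 ∷ mul 12 4 0 ∷ const 13 3 ∷
  -- 27: loop with counter in register 13
  const 6 0 ∷ jeq 13 6 40 ∷
  mul 14 1 11 ∷ mul 15 2 11 ∷ sub 15 10 15 ∷ sub 16 14 12 ∷ jlt 12 14 35 ∷ jmp 36 ∷ out 15 16 ∷
  const 5 1 ∷ sub 11 11 5 ∷ sub 13 13 5 ∷ jmp 27 ∷
  halt ∷ []

Ends : Config → ℕ → List (ℕ × ℕ) → Set
Ends c K o = ∀ f → run program (K + f) c ≡ just o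

ends-mono : ∀ {c K K′ o} → K ≤ K′ → Ends c K o → Ends c K′ o
ends-mono {c} {K} {K′} {o} K≤K′ ends f =
  subst (λ F → run program F c ≡ just o) (trans (sym (+-assoc K (K′ ∸ K) f)) (cong (_+ f) (m+[n∸m]≡n K≤K′)))
    (ends (K′ ∸ K + f))

-- Only used to name the register file at a point of a run.
after : ℕ → Config → Config
after zero c = c
after (suc k) c = after k (exec (fromMaybe halt (fetch program (Config.pc c))) c)

ends-if-true : ∀ {b t e σ acc K o} → b ≡ true → Ends (cfg t σ acc) K o → Ends (cfg (if b then t else e) σ acc) K o
ends-if-true refl ends = ends

ends-if-false : ∀ {b t e σ acc K o} → b ≡ false → Ends (cfg e σ acc) K o → Ends (cfg (if b then t else e) σ acc) K o
ends-if-false refl ends = ends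

emit-loop : ∀ c τ acc → τ 13 ≡ c →
  Ends (cfg 27 τ acc) (c * 12 + 2)
    (reverse (collectDown (λ y → τ 12 <ᵇ τ 1 * y) (λ y → τ 10 ∸ τ 2 * y , τ 1 * y ∸ τ 12) c (τ 11) acc))
emit-loop zero τ acc τ13≡0 = ends-if-true (cong (_≡ᵇ 0) τ13≡0) (λ _ → refl)
emit-loop (suc c) τ acc τ13≡1+c with τ 12 <ᵇ τ 1 * τ 11 in above
... | true = ends-if-false (cong (_≡ᵇ 0) τ13≡1+c) (ends-if-true above (emit-loop c _ _ (cong (_∸ 1) τ13≡1+c)))
... | false = ends-if-false (cong (_≡ᵇ 0) τ13≡1+c) (ends-if-false above (emit-loop c _ _ (cong (_∸ 1) τ13≡1+c)))

output-candidates : ∀ {s} σ (n≥1 : 1 ≤ σ 0) (coeffs : Coefficients s (σ 1) (σ 2) (σ 3) (σ 4)) →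
  Ends (cfg 14 σ []) 45 (reverse (Level.candidates n≥1 coeffs))
output-candidates σ n≥1 coeffs = emit-loop 3 (Config.regs (after 7 (cfg 14 σ []))) [] refl

last-level : ∀ {s} σ (n≥1 : 1 ≤ σ 0) (coeffs : Coefficients s (σ 1) (σ 2) (σ 3) (σ 4)) →
  Level.βn<ᵇP* n≥1 (coefficients-next coeffs) (Level.top n≥1 (coefficients-next coeffs)) ≡ false →
  Ends (cfg 3 σ []) 56 (reverse (Level.candidates n≥1 coeffs))
-- Leaving these implicit arguments to unification makes Agda evaluate both runs in full.
last-level σ n≥1 coeffs test =
  ends-if-false {t = 15} {e = 14} {σ = τ} {acc = []} {K = 45} {o = reverse (Level.candidates n≥1 coeffs)} test (output-candidates τ n≥1 coeffs)
  where τ = Config.regs (after 10 (cfg 3 σ []))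

level-loop : ∀ k s σ → 1 ≤ σ 0 → Coefficients s (σ 1) (σ 2) (σ 3) (σ 4) →
  Reachable (σ 0) s → ¬ Reachable (σ 0) (k + s) →
  ∃[ o ] (Ends (cfg 3 σ []) (k * 17 + 56) o × ∀ a b → (a , b) ∈ o ⇔ Good (σ 0) a b)
level-loop zero s σ n≥1 coeffs reachable unreachable = ⊥-elim (unreachable reachable)
level-loop (suc k) s σ n≥1 coeffs reachable unreachable = branch _ refl
  where
  module Next = Level n≥1 (coefficients-next coeffs)
  τ : ℕ → ℕ
  τ = Config.regs (after 10 (cfg 3 σ []))
  branch : ∀ b → Next.βn<ᵇP* Next.top ≡ b →
    ∃[ o ] (Ends (cfg 3 σ []) (suc k * 17 + 56) o × ∀ a b → (a , b) ∈ o ⇔ Good (σ 0) a b)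
  branch true test =
    let (o , ends , o⇔good) = level-loop k (suc s) _ n≥1 (coefficients-next coeffs) reachable′ unreachable′
    in o , ends-if-true {σ = τ} {K = 6 + (k * 17 + 56)} test ends , o⇔good
    where
    reachable′ : Reachable (σ 0) (suc s)
    reachable′ = Equivalence.from Next.reachable⇔ (<ᵇ⇒< _ _ (subst T (sym test) tt))
    unreachable′ : ¬ Reachable (σ 0) (k + suc s)
    unreachable′ r = unreachable (subst (Reachable (σ 0)) (+-suc k s) r)
  branch false test = reverse (Level.candidates n≥1 coeffs) ,
    ends-mono {c = cfg 3 σ []} {K = 56} (m≤n+m 56 (suc k * 17)) (last-level σ n≥1 coeffs test) ,
    λ a b → ⇔-trans reverse⇔ (Level.candidates⇔good n≥1 coeffs reachable unreachable′ a b)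
    where
    unreachable′ : ¬ Reachable (σ 0) (suc s)
    unreachable′ r = subst T test (<⇒<ᵇ (Equivalence.to Next.reachable⇔ r))
    reverse⇔ : ∀ {z} {xs : List (ℕ × ℕ)} → z ∈ reverse xs ⇔ z ∈ xs
    reverse⇔ = mk⇔ reverse⁻ reverse⁺

n<2^[1+⌊log₂n⌋] : ∀ n → n < 2 ^ suc ⌊log₂ n ⌋
n<2^[1+⌊log₂n⌋] n with 2 ^ suc ⌊log₂ n ⌋ ≤? n
... | no 2^[1+⌊log₂n⌋]≰n = ≰⇒> 2^[1+⌊log₂n⌋]≰n
... | yes 2^[1+⌊log₂n⌋]≤n = ⊥-elim (<-irrefl refl
  (subst (_≤ ⌊log₂ n ⌋) (⌊log₂[2^n]⌋≡n (suc ⌊log₂ n ⌋)) (⌊log₂⌋-mono-≤ 2^[1+⌊log₂n⌋]≤n)))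

2^m≤fib[2+m+m] : ∀ m → 2 ^ m ≤ fib (2 + (m + m))
2^m≤fib[2+m+m] zero = s≤s z≤n
2^m≤fib[2+m+m] (suc m) = begin
  2 ^ m + (2 ^ m + 0)        ≤⟨ +-mono-≤ ih (+-monoˡ-≤ 0 ih) ⟩
  F + (F + 0)                ≡⟨ cong (F +_) (+-identityʳ F) ⟩
  F + F                      ≤⟨ +-monoˡ-≤ F (fib-≤-suc (2 + (m + m))) ⟩
  fib (4 + (m + m))          ≡⟨ cong (λ t → fib (3 + t)) (+-suc m m) ⟨
  fib (2 + (suc m + suc m))  ∎
  where
  open ≤-Reasoning
  ih = 2^m≤fib[2+m+m] m
  F = fib (2 + (m + m))

fib≤walk : ∀ {a b} m → 1 ≤ a → 1 ≤ b → fib (2 + m) ≤ walk a b (2 + m)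
fib≤walk {a} {b} m a≥1 b≥1 = begin
  fib (1 + m) + fib m          ≡⟨ +-comm (fib (1 + m)) (fib m) ⟩
  fib m + fib (1 + m)          ≡⟨ cong₂ _+_ (*-identityʳ (fib m)) (*-identityʳ (fib (1 + m))) ⟨
  fib m * 1 + fib (1 + m) * 1  ≤⟨ +-mono-≤ (*-monoʳ-≤ (fib m) a≥1) (*-monoʳ-≤ (fib (1 + m)) b≥1) ⟩
  fib m * a + fib (1 + m) * b  ≡⟨ walk-fib a b m ⟨
  walk a b (2 + m)             ∎
  where open ≤-Reasoning

unreachable-after-log : ∀ n → ¬ Reachable n (2 + (suc ⌊log₂ n ⌋ + suc ⌊log₂ n ⌋))
unreachable-after-log n (a , b , a≥1 , b≥1 , hit) = <⇒≱ (n<2^[1+⌊log₂n⌋] n) (begin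
  2 ^ L                 ≤⟨ 2^m≤fib[2+m+m] L ⟩
  fib (2 + (L + L))     ≤⟨ fib≤walk (L + L) a≥1 b≥1 ⟩
  walk a b (2 + (L + L)) ≡⟨ hit ⟩
  n                     ∎)
  where
  open ≤-Reasoning
  L = suc ⌊log₂ n ⌋

reachable-3 : ∀ {n} → 2 ≤ n → Reachable n 3
reachable-3 n≥2 = 1 , _ , s≤s z≤n , m<n⇒0<n∸m n≥2 , m∸n+n≡m (≤-trans (s≤s z≤n) n≥2)

proposition17 : ∃[ P ] ∃[ C ] (∀ n → 2 ≤ n →
                    ∃[ t ] ∃[ o ] (t ≤ C * suc ⌊log₂ n ⌋ × HaltsWith P n t o
                      × (∀ a₁ a₂ → ((a₁ , a₂) ∈ o) ⇔ Good n a₁ a₂)))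
proposition17 = program , 76 , λ n n≥2 →
  let L = ⌊log₂ n ⌋
      k = L + L + 1
      σ = Config.regs (after 3 (initial n))
      (o , ends , o⇔good) = level-loop k 3 σ (≤-trans (s≤s z≤n) n≥2) coefficients-3 (reachable-3 n≥2)
                              (subst (λ s → ¬ Reachable n s) (level L) (unreachable-after-log n))
  in 3 + (k * 17 + 56 + 0) , o , cost L , ends 0 , o⇔good
  where
  level : ∀ L → 2 + (suc L + suc L) ≡ L + L + 1 + 3
  level = solve-∀
  cost : ∀ L → 3 + ((L + L + 1) * 17 + 56 + 0) ≤ 76 * suc L
  cost L = begin
    3 + ((L + L + 1) * 17 + 56 + 0)  ≡⟨ l₁ L ⟩
    76 + L * 34                      ≤⟨ +-monoʳ-≤ 76 (*-monoʳ-≤ L (m≤m+n 34 42)) ⟩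
    76 + L * 76                      ≡⟨ l₂ L ⟩
    76 * suc L                       ∎
    where
    open ≤-Reasoning
    l₁ : ∀ L → 3 + ((L + L + 1) * 17 + 56 + 0) ≡ 76 + L * 34
    l₁ = solve-∀
    l₂ : ∀ L → 76 + L * 76 ≡ 76 * suc L
    l₂ = solve-∀
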